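{- For $n\ge0$, the approximating multigraph $G_n$ of the non-p.c.f. analog of the Sierpiński gasket has $\frac{4\cdot6^n+11}{5}$ vertices. Among them, (i) $3$ have degree $2^{n+1}$; (ii) for each $1\le k\le n$, $6^{k-1}$ have degree $3\cdot2^{n-k+2}$; (iii) for each $1\le k\le n$, $3\cdot6^{k-1}$ have degree $2^{n-k+2}$.
   Context: $G_0$ is a single triangle (3-cycle) on vertices $x_1,x_2,x_3$. $G_n$ is obtained from $G_{n-1}$ by replacing each triangle with vertices $a,b,c$ by six triangles, using four new vertices $m_{ab},m_{bc},m_{ca},o$ (distinct for distinct triangles): $\{a,m_{ab},o\},\{m_{ab},b,o\},\{b,m_{bc},o\},\{m_{bc},c,o\},\{c,m_{ca},o\},\{m_{ca},a,o\}$. The edge multiset of $G_n$ is the multiset union of the three edges of each triangle; degrees count edges with multiplicity. (These are the approximating graphs of the self-affine non-p.c.f. analog of the Sierpiński gasket, generated by six affine contractions obtained from the one with fixed point $(0,0)$ and matrix $\begin{pmatrix}1/2&1/6\\1/4&1/4\end{pmatrix}$ via the symmetries of the equilateral triangle.) -}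

module Defs where

open import Data.Nat using (ℕ; zero; suc; _+_)
open import Data.Fin using (Fin)
import Data.Fin.Properties as FinP
open import Data.List using (List; []; _∷_; length; concatMap; deduplicate; filter; map)
import Data.List.Properties as ListP
open import Data.Product using (_×_; _,_)
open import Relation.Nullary using (yes; no; Dec)
open import Relation.Binary.PropositionalEquality using (_≡_; refl; cong; cong₂)
open import Relation.Binary.Definitions using (DecidableEquality)

-- Vertices of the approximating graphs, named by how they were created.
--   corner i      : the original vertices x₁, x₂, x₃ of G₀
--   center w      : the new vertex o of the triangle with address w
--   mid w j       : the new vertex m_ab (j=0), m_bc (j=1), m_ca (j=2) of the
--                   triangle with address w  (triangle with vertices a,b,c)
-- A triangle of G_m has an address w ∈ (Fin 6)^m, so the vertices
-- introduced when passing from G_{k-1} to G_k are exactly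
-- center w / mid w j with length w = k - 1.  Distinct triangles give
-- distinct new vertices, as required.
data Vtx : Set where
  corner : Fin 3 → Vtx
  center : List (Fin 6) → Vtx
  mid    : List (Fin 6) → Fin 3 → Vtx

_≟V_ : DecidableEquality Vtx
corner i ≟V corner j with i FinP.≟ j
... | yes refl = yes refl
... | no ne = no λ { refl → ne refl }
corner _ ≟V center _ = no λ ()
corner _ ≟V mid _ _ = no λ ()
center _ ≟V corner _ = no λ ()
center v ≟V center w with ListP.≡-dec FinP._≟_ v w
... | yes refl = yes refl
... | no ne = no λ { refl → ne refl }
center _ ≟V mid _ _ = no λ ()
mid _ _ ≟V corner _ = no λ ()
mid _ _ ≟V center _ = no λ ()
mid v i ≟V mid w j with ListP.≡-dec FinP._≟_ v w | i FinP.≟ j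
... | yes refl | yes refl = yes refl
... | no ne | _ = no λ { refl → ne refl }
... | _ | no ne = no λ { refl → ne refl }

Triangle : Set
Triangle = Vtx × Vtx × Vtx

ATriangle : Set
ATriangle = List (Fin 6) × Triangle

subdivide : ATriangle → List ATriangle
subdivide (w , (a , b , c)) =
    (Fin.zero ∷ w , (a , mab , o))
  ∷ (Fin.suc Fin.zero ∷ w , (mab , b , o))
  ∷ (Fin.suc (Fin.suc Fin.zero) ∷ w , (b , mbc , o))
  ∷ (Fin.suc (Fin.suc (Fin.suc Fin.zero)) ∷ w , (mbc , c , o))
  ∷ (Fin.suc (Fin.suc (Fin.suc (Fin.suc Fin.zero))) ∷ w , (c , mca , o))
  ∷ (Fin.suc (Fin.suc (Fin.suc (Fin.suc (Fin.suc Fin.zero)))) ∷ w , (mca , a , o))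
  ∷ []
  where
  o   = center w
  mab = mid w Fin.zero
  mbc = mid w (Fin.suc Fin.zero)
  mca = mid w (Fin.suc (Fin.suc Fin.zero))

triangles : ℕ → List ATriangle
triangles zero = ([] , (corner Fin.zero , corner (Fin.suc Fin.zero) , corner (Fin.suc (Fin.suc Fin.zero)))) ∷ []
triangles (suc n) = concatMap subdivide (triangles n)

Edge : Set
Edge = Vtx × Vtx

triEdges : ATriangle → List Edge
triEdges (_ , (a , b , c)) = (a , b) ∷ (b , c) ∷ (c , a) ∷ []

edges : ℕ → List Edge
edges n = concatMap triEdges (triangles n)

vertices : ℕ → List Vtx
vertices n = deduplicate _≟V_ (concatMap (λ { (_ , (a , b , c)) → a ∷ b ∷ c ∷ [] }) (triangles n))

hits : Vtx → Vtx → ℕ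
hits x v with x ≟V v
... | yes _ = 1
... | no _ = 0

degreeIn : List Edge → Vtx → ℕ
degreeIn [] v = 0
degreeIn ((x , y) ∷ es) v = hits x v + hits y v + degreeIn es v

degree : ℕ → Vtx → ℕ
degree n = degreeIn (edges n)

-- Classes of vertices: original vertices, and the vertices o resp. m_**
-- introduced at step k (passing from G_{k-1} to G_k).
data VClass : Set where
  original : VClass
  centerAt : ℕ → VClass
  midAt    : ℕ → VClass

classOf : Vtx → VClass
classOf (corner _) = original
classOf (center w) = centerAt (suc (length w))
classOf (mid w _)  = midAt (suc (length w))

_≟C_ : DecidableEquality VClass
original ≟C original = yes refl
original ≟C centerAt _ = no λ ()
original ≟C midAt _ = no λ ()
centerAt _ ≟C original = no λ ()
centerAt k ≟C centerAt l with k Data.Nat.≟ l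
... | yes refl = yes refl
... | no ne = no λ { refl → ne refl }
centerAt _ ≟C midAt _ = no λ ()
midAt _ ≟C original = no λ ()
midAt _ ≟C centerAt _ = no λ ()
midAt k ≟C midAt l with k Data.Nat.≟ l
... | yes refl = yes refl
... | no ne = no λ { refl → ne refl }

verticesOf : ℕ → VClass → List Vtx
verticesOf n c = filter (λ v → classOf v ≟C c) (vertices n)

module Submission where

-- Each triangle contributes 2 to the degree of each of its
-- corners, so deg_n(v) = 2·I_n(v), where the incidence I_n(v) is the number
-- of triangles of G_n having v as a corner.  Subdividing a triangle with
-- address w doubles the incidence of its corners, and adds 6 to the
-- incidence of its centre and 2 to that of each midpoint.  The addresses of
-- the triangles of G_n are exactly the words of length n over Fin 6, each
-- occurring once; hence a vertex created in the triangle with address u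
-- has incidence 0 up to level |u|, then 6 (centre) or 2 (midpoint), and
-- doubles afterwards.
--
-- Without repetitions, the vertices of G_n are the three
-- original corners followed by the layers of new vertices of G_0, …,
-- G_{n-1}; the layer created from G_m has 4·6^m vertices, 6^m centres and
-- 3·6^m midpoints, all of class level m+1.

open import Defs
open import Data.Nat using (ℕ; zero; suc; _+_; _*_; _∸_; _^_; _≤_; _/_; z≤n; s≤s)
open import Data.Nat.Properties
open import Data.Nat.DivMod using (m*n/n≡m)
open import Data.Nat.Tactic.RingSolver using (solve-∀)
open import Data.Fin using (Fin)
open import Data.Fin.Patterns using (0F; 1F; 2F; 3F; 4F; 5F)
open import Data.List using (List; []; _∷_; _++_; length; concatMap; map; filter; drop)
import Data.List.Properties as ListP
open import Data.List.Relation.Unary.All using (All; []; _∷_)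
import Data.List.Relation.Unary.All as All
open import Data.List.Relation.Unary.Any using (here; there)
import Data.List.Relation.Unary.Any.Properties as AnyP
open import Data.List.Relation.Unary.Unique.Propositional using (Unique)
open import Data.List.Relation.Unary.AllPairs using ([]; _∷_)
import Data.List.Relation.Unary.Unique.Propositional.Properties as UniqueP
open import Data.List.Relation.Unary.Unique.DecPropositional.Properties _≟V_ using (deduplicate-!)
open import Data.List.Membership.Propositional using (_∈_; _∉_; find; lose)
open import Data.List.Membership.Propositional.Properties using (∈-++⁺ˡ; ∈-++⁺ʳ; ∈-++⁻; ∈-map⁺; ∈-concatMap⁺; ∈-concatMap⁻; ∈-filter⁻; ∈-deduplicate⁻; ∈-deduplicate⁺)
open import Data.List.Membership.Propositional.Properties.WithK using (unique∧set⇒bag)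
open import Data.List.Relation.Binary.Subset.Propositional using (_⊆_)
open import Data.List.Relation.Binary.Subset.Propositional.Properties using (++⁺)
open import Data.List.Relation.Binary.BagAndSetEquality using (∼bag⇒↭)
open import Data.List.Relation.Binary.Permutation.Propositional using (_↭_)
open import Data.List.Relation.Binary.Permutation.Propositional.Properties using (↭-length; filter-↭)
open import Data.Product using (Σ; _×_; _,_; proj₁; proj₂)
open import Data.Sum using (inj₁; inj₂)
open import Data.Empty using (⊥-elim)
open import Level using (Level)
open import Function using (_∘_; id)
open import Function.Bundles using (mk⇔)
open import Relation.Nullary using (yes; no; ¬_)
open import Relation.Unary using (Pred; Decidable)
open import Relation.Binary.PropositionalEquality

sumOf : {A : Set} → (A → ℕ) → List A → ℕ
sumOf f [] = 0
sumOf f (x ∷ xs) = f x + sumOf f xs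

sumOf-++ : {A : Set} (f : A → ℕ) (xs ys : List A) → sumOf f (xs ++ ys) ≡ sumOf f xs + sumOf f ys
sumOf-++ f [] ys = refl
sumOf-++ f (x ∷ xs) ys = trans (cong (f x +_) (sumOf-++ f xs ys)) (sym (+-assoc (f x) _ _))

sumOf-concatMap : {A B : Set} (f : B → ℕ) (g : A → List B) (xs : List A) →
  sumOf f (concatMap g xs) ≡ sumOf (sumOf f ∘ g) xs
sumOf-concatMap f g [] = refl
sumOf-concatMap f g (x ∷ xs) =
  trans (sumOf-++ f (g x) (concatMap g xs)) (cong (sumOf f (g x) +_) (sumOf-concatMap f g xs))

sumOf-map : {A B : Set} (f : B → ℕ) (g : A → B) (xs : List A) → sumOf f (map g xs) ≡ sumOf (f ∘ g) xs
sumOf-map f g [] = refl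
sumOf-map f g (x ∷ xs) = cong (f (g x) +_) (sumOf-map f g xs)

sumOf-cong : {A : Set} {f g : A → ℕ} → (∀ x → f x ≡ g x) → (xs : List A) → sumOf f xs ≡ sumOf g xs
sumOf-cong f≡g [] = refl
sumOf-cong f≡g (x ∷ xs) = cong₂ _+_ (f≡g x) (sumOf-cong f≡g xs)

sumOf-+ : {A : Set} (f g : A → ℕ) (xs : List A) → sumOf (λ x → f x + g x) xs ≡ sumOf f xs + sumOf g xs
sumOf-+ f g [] = refl
sumOf-+ f g (x ∷ xs) = trans (cong (f x + g x +_) (sumOf-+ f g xs)) (interchange (f x) (g x) _ _)
  where
  interchange : ∀ a b c d → a + b + (c + d) ≡ a + c + (b + d)
  interchange = solve-∀

sumOf-* : {A : Set} (k : ℕ) (f : A → ℕ) (xs : List A) → sumOf (λ x → k * f x) xs ≡ k * sumOf f xs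
sumOf-* k f [] = sym (*-zeroʳ k)
sumOf-* k f (x ∷ xs) = trans (cong (k * f x +_) (sumOf-* k f xs)) (sym (*-distribˡ-+ k (f x) _))

sumOf-zero : {A : Set} (f : A → ℕ) (xs : List A) → (∀ {x} → x ∈ xs → f x ≡ 0) → sumOf f xs ≡ 0
sumOf-zero f [] vanish = refl
sumOf-zero f (x ∷ xs) vanish = cong₂ _+_ (vanish (here refl)) (sumOf-zero f xs (vanish ∘ there))

module Indicator {A : Set} (δ : A → ℕ) {u : A} (δ-off : ∀ {x} → x ≢ u → δ x ≡ 0) where

  indicator-sum-∉ : ∀ {xs} → u ∉ xs → sumOf δ xs ≡ 0
  indicator-sum-∉ {xs} u∉xs = sumOf-zero δ xs (λ x∈xs → δ-off (λ { refl → u∉xs x∈xs }))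

  indicator-sum-∈ : δ u ≡ 1 → ∀ {xs} → Unique xs → u ∈ xs → sumOf δ xs ≡ 1
  indicator-sum-∈ δu (x∉xs ∷ _) (here refl) =
    cong₂ _+_ δu (indicator-sum-∉ (λ u∈xs → All.lookup x∉xs u∈xs refl))
  indicator-sum-∈ δu (x∉xs ∷ unique) (there u∈xs) =
    cong₂ _+_ (δ-off (All.lookup x∉xs u∈xs)) (indicator-sum-∈ δu unique u∈xs)

open Indicator

-- concatMap f keeps a list duplicate-free when every block f a is
-- duplicate-free and g recovers a from each element of f a (so distinct
-- blocks are disjoint).
unique-concatMap : {A B : Set} (f : A → List B) (g : B → A) → (∀ {a b} → b ∈ f a → g b ≡ a) →
  (∀ a → Unique (f a)) → ∀ {as} → Unique as → Unique (concatMap f as)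
unique-concatMap f g g-recovers f-unique {[]} [] = []
unique-concatMap f g g-recovers f-unique {a ∷ as} (a∉as ∷ unique) =
  UniqueP.++⁺ (f-unique a) (unique-concatMap f g g-recovers f-unique unique) disjoint
  where
  disjoint : ∀ {b} → ¬ (b ∈ f a × b ∈ concatMap f as)
  disjoint (b∈fa , b∈rest) with find (∈-concatMap⁻ f b∈rest)
  ... | a′ , a′∈as , b∈fa′ = All.lookup a∉as a′∈as (trans (sym (g-recovers b∈fa)) (g-recovers b∈fa′))

length-concatMap-uniform : {A B : Set} (f : A → List B) {m : ℕ} (xs : List A) →
  (∀ {x} → x ∈ xs → length (f x) ≡ m) → length (concatMap f xs) ≡ length xs * m
length-concatMap-uniform f [] uniform = refl
length-concatMap-uniform f (x ∷ xs) uniform =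
  trans (ListP.length-++ (f x)) (cong₂ _+_ (uniform (here refl)) (length-concatMap-uniform f xs (uniform ∘ there)))

filter-concatMap : {A B : Set} {ℓ : Level} {P : Pred B ℓ} (P? : Decidable P) (f : A → List B) (xs : List A) →
  filter P? (concatMap f xs) ≡ concatMap (filter P? ∘ f) xs
filter-concatMap P? f [] = refl
filter-concatMap P? f (x ∷ xs) =
  trans (ListP.filter-++ P? (f x) (concatMap f xs)) (cong (filter P? (f x) ++_) (filter-concatMap P? f xs))

appears-then-scales : (f g : ℕ → ℕ) (a L κ : ℕ) → f 0 ≡ 0 →
  (∀ n → f (suc n) ≡ a * f n + g n) → (∀ n → n ≢ L → g n ≡ 0) → g L ≡ κ →
  ∀ n → suc L ≤ n → f n ≡ κ * a ^ (n ∸ suc L)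
appears-then-scales f g a L κ f0 step quiet burst n L<n =
  subst (λ m → f m ≡ κ * a ^ (n ∸ suc L)) (m∸n+n≡m L<n) (after (n ∸ suc L))
  where
  open ≡-Reasoning

  before : ∀ m → m ≤ L → f m ≡ 0
  before zero _ = f0
  before (suc m) m<L = begin
    f (suc m)      ≡⟨ step m ⟩
    a * f m + g m  ≡⟨ cong₂ _+_ (cong (a *_) (before m (<⇒≤ m<L))) (quiet m (<⇒≢ m<L)) ⟩
    a * 0 + 0      ≡⟨ cong (_+ 0) (*-zeroʳ a) ⟩
    0              ∎

  after : ∀ d → f (d + suc L) ≡ κ * a ^ d
  after zero = begin
    f (suc L)      ≡⟨ step L ⟩
    a * f L + g L  ≡⟨ cong₂ _+_ (cong (a *_) (before L ≤-refl)) burst ⟩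
    a * 0 + κ      ≡⟨ cong (_+ κ) (*-zeroʳ a) ⟩
    κ              ≡⟨ *-identityʳ κ ⟨
    κ * 1          ∎
  after (suc d) = begin
    f (suc (d + suc L))                  ≡⟨ step (d + suc L) ⟩
    a * f (d + suc L) + g (d + suc L)    ≡⟨ cong₂ _+_ (cong (a *_) (after d)) (quiet _ (>⇒≢ (m≤n+m (suc L) d))) ⟩
    a * (κ * a ^ d) + 0                  ≡⟨ rearrange a κ (a ^ d) ⟩
    κ * (a * a ^ d)                      ∎
    where
    rearrange : ∀ x y z → x * (y * z) + 0 ≡ y * (x * z)
    rearrange = solve-∀

hits-self : ∀ x → hits x x ≡ 1
hits-self x with x ≟V x
... | yes _ = refl
... | no x≢x = ⊥-elim (x≢x refl)

hits-distinct : ∀ {x v} → x ≢ v → hits x v ≡ 0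
hits-distinct {x} {v} x≢v with x ≟V v
... | yes x≡v = ⊥-elim (x≢v x≡v)
... | no _ = refl

hits-cong : ∀ {x v y w} → (x ≡ v → y ≡ w) → (y ≡ w → x ≡ v) → hits x v ≡ hits y w
hits-cong {x} {v} {y} {w} to from with x ≟V v | y ≟V w
... | yes _ | yes _ = refl
... | no _ | no _ = refl
... | yes x≡v | no y≢w = ⊥-elim (y≢w (to x≡v))
... | no x≢v | yes y≡w = ⊥-elim (x≢v (from y≡w))

cornerHits : Vtx → ATriangle → ℕ
cornerHits v (_ , (a , b , c)) = hits a v + hits b v + hits c v

incidence : ℕ → Vtx → ℕ
incidence n v = sumOf (cornerHits v) (triangles n)

degreeIn-++ : ∀ es fs v → degreeIn (es ++ fs) v ≡ degreeIn es v + degreeIn fs v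
degreeIn-++ [] fs v = refl
degreeIn-++ ((x , y) ∷ es) fs v =
  trans (cong (hits x v + hits y v +_) (degreeIn-++ es fs v)) (sym (+-assoc (hits x v + hits y v) _ _))

-- Each corner of a triangle lies on two of its three edges.
degreeIn-triEdges : ∀ v t → degreeIn (triEdges t) v ≡ 2 * cornerHits v t
degreeIn-triEdges v (_ , (a , b , c)) = twice (hits a v) (hits b v) (hits c v)
  where
  twice : ∀ x y z → x + y + (y + z + (z + x + 0)) ≡ 2 * (x + y + z)
  twice = solve-∀

degree≡2*incidence : ∀ n v → degree n v ≡ 2 * incidence n v
degree≡2*incidence n v = go (triangles n)
  where
  go : ∀ ts → degreeIn (concatMap triEdges ts) v ≡ 2 * sumOf (cornerHits v) ts
  go [] = refl
  go (t ∷ ts) = trans (degreeIn-++ (triEdges t) (concatMap triEdges ts) v)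
    (trans (cong₂ _+_ (degreeIn-triEdges v t) (go ts)) (sym (*-distribˡ-+ 2 (cornerHits v t) _)))

-- Incidence that v gains from the new vertices of the triangle with
-- address w: each midpoint is a corner of two children, the centre of six.
newHits : Vtx → List (Fin 6) → ℕ
newHits v w = 2 * (hits (mid w 0F) v + hits (mid w 1F) v + hits (mid w 2F) v) + 6 * hits (center w) v

-- Each old corner of t is a corner of exactly two of its children.
subdivide-hits : ∀ v t → sumOf (cornerHits v) (subdivide t) ≡ 2 * cornerHits v t + newHits v (proj₁ t)
subdivide-hits v (w , (a , b , c)) =
  count (hits a v) (hits b v) (hits c v) (hits (mid w 0F) v) (hits (mid w 1F) v) (hits (mid w 2F) v) (hits (center w) v)
  where
  count : ∀ a b c m₀ m₁ m₂ o →
    a + m₀ + o + (m₀ + b + o + (b + m₁ + o + (m₁ + c + o + (c + m₂ + o + (m₂ + a + o + 0)))))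
      ≡ 2 * (a + b + c) + (2 * (m₀ + m₁ + m₂) + 6 * o)
  count = solve-∀

addresses : ℕ → List (List (Fin 6))
addresses n = map proj₁ (triangles n)

children : List (Fin 6) → List (List (Fin 6))
children w = (0F ∷ w) ∷ (1F ∷ w) ∷ (2F ∷ w) ∷ (3F ∷ w) ∷ (4F ∷ w) ∷ (5F ∷ w) ∷ []

addresses-suc : ∀ n → addresses (suc n) ≡ concatMap children (addresses n)
addresses-suc n = trans (ListP.map-concatMap proj₁ subdivide (triangles n))
                        (sym (ListP.concatMap-map children proj₁ (triangles n)))

children-shape : ∀ {w x} → x ∈ children w → Σ (Fin 6) (λ i → x ≡ i ∷ w)
children-shape (here refl) = 0F , refl
children-shape (there (here refl)) = 1F , refl
children-shape (there (there (here refl))) = 2F , refl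
children-shape (there (there (there (here refl)))) = 3F , refl
children-shape (there (there (there (there (here refl))))) = 4F , refl
children-shape (there (there (there (there (there (here refl)))))) = 5F , refl

children-parent : ∀ {w x} → x ∈ children w → drop 1 x ≡ w
children-parent x∈ = cong (drop 1) (proj₂ (children-shape x∈))

children-length : ∀ {w x} → x ∈ children w → length x ≡ suc (length w)
children-length x∈ = cong length (proj₂ (children-shape x∈))

∈-children : ∀ i w → (i ∷ w) ∈ children w
∈-children 0F w = here refl
∈-children 1F w = there (here refl)
∈-children 2F w = there (there (here refl))
∈-children 3F w = there (there (there (here refl)))
∈-children 4F w = there (there (there (there (here refl))))
∈-children 5F w = there (there (there (there (there (here refl)))))

children-unique : ∀ w → Unique (children w)
children-unique w =
    ((λ ()) ∷ (λ ()) ∷ (λ ()) ∷ (λ ()) ∷ (λ ()) ∷ []) ∷ ((λ ()) ∷ (λ ()) ∷ (λ ()) ∷ (λ ()) ∷ [])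
  ∷ ((λ ()) ∷ (λ ()) ∷ (λ ()) ∷ []) ∷ ((λ ()) ∷ (λ ()) ∷ []) ∷ ((λ ()) ∷ []) ∷ [] ∷ []

addresses-length : ∀ n {w} → w ∈ addresses n → length w ≡ n
addresses-length zero (here refl) = refl
addresses-length (suc n) w∈ with find (∈-concatMap⁻ children (subst (_ ∈_) (addresses-suc n) w∈))
... | w′ , w′∈ , w∈children = trans (children-length w∈children) (cong suc (addresses-length n w′∈))

addresses-complete : ∀ n {w} → length w ≡ n → w ∈ addresses n
addresses-complete zero {[]} refl = here refl
addresses-complete (suc n) {i ∷ w} |w|≡n = subst (_ ∈_) (sym (addresses-suc n))
  (∈-concatMap⁺ children (lose (addresses-complete n (suc-injective |w|≡n)) (∈-children i w)))

addresses-unique : ∀ n → Unique (addresses n)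
addresses-unique zero = [] ∷ []
addresses-unique (suc n) = subst Unique (sym (addresses-suc n))
  (unique-concatMap children (drop 1) children-parent children-unique (addresses-unique n))

length-addresses : ∀ n → length (addresses n) ≡ 6 ^ n
length-addresses zero = refl
length-addresses (suc n) = begin
  length (addresses (suc n))              ≡⟨ cong length (addresses-suc n) ⟩
  length (concatMap children (addresses n)) ≡⟨ length-concatMap-uniform children (addresses n) (λ _ → refl) ⟩
  length (addresses n) * 6                ≡⟨ cong (_* 6) (length-addresses n) ⟩
  6 ^ n * 6                               ≡⟨ *-comm (6 ^ n) 6 ⟩
  6 ^ suc n                               ∎
  where open ≡-Reasoning

addressCount : ℕ → List (Fin 6) → ℕ
addressCount n u = sumOf (λ w → hits (center w) (center u)) (addresses n)

-- As the addresses of G_n are the words of length n, each occurring once,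
-- addressCount n u is 1 if |u| = n and 0 otherwise.
center-hits-off : ∀ {u w} → w ≢ u → hits (center w) (center u) ≡ 0
center-hits-off w≢u = hits-distinct (λ { refl → w≢u refl })

addressCount-here : ∀ u → addressCount (length u) u ≡ 1
addressCount-here u = indicator-sum-∈ _ center-hits-off (hits-self (center u))
  (addresses-unique (length u)) (addresses-complete (length u) refl)

addressCount-elsewhere : ∀ {n u} → n ≢ length u → addressCount n u ≡ 0
addressCount-elsewhere {n} n≢|u| = indicator-sum-∉ _ center-hits-off (λ u∈ → n≢|u| (sym (addresses-length n u∈)))

incidence-suc : ∀ n v → incidence (suc n) v ≡ 2 * incidence n v + sumOf (newHits v) (addresses n)
incidence-suc n v = begin
  sumOf (cornerHits v) (concatMap subdivide ts)                          ≡⟨ sumOf-concatMap (cornerHits v) subdivide ts ⟩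
  sumOf (sumOf (cornerHits v) ∘ subdivide) ts                            ≡⟨ sumOf-cong (subdivide-hits v) ts ⟩
  sumOf (λ t → 2 * cornerHits v t + newHits v (proj₁ t)) ts              ≡⟨ sumOf-+ _ _ ts ⟩
  sumOf (λ t → 2 * cornerHits v t) ts + sumOf (newHits v ∘ proj₁) ts    ≡⟨ cong₂ _+_ (sumOf-* 2 (cornerHits v) ts) (sym (sumOf-map (newHits v) proj₁ ts)) ⟩
  2 * incidence n v + sumOf (newHits v) (addresses n)                    ∎
  where
  open ≡-Reasoning
  ts : List ATriangle
  ts = triangles n

incidence-corner : ∀ n i → incidence n (corner i) ≡ 2 ^ n
incidence-corner zero 0F = refl
incidence-corner zero 1F = refl
incidence-corner zero 2F = refl
incidence-corner (suc n) i = begin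
  incidence (suc n) (corner i)                                          ≡⟨ incidence-suc n (corner i) ⟩
  2 * incidence n (corner i) + sumOf (newHits (corner i)) (addresses n) ≡⟨ cong₂ _+_ (cong (2 *_) (incidence-corner n i)) (sumOf-zero _ (addresses n) (λ _ → refl)) ⟩
  2 * 2 ^ n + 0                                                         ≡⟨ +-identityʳ _ ⟩
  2 ^ suc n                                                             ∎
  where open ≡-Reasoning

incidence-center : ∀ n u → incidence (suc n) (center u) ≡ 2 * incidence n (center u) + 6 * addressCount n u
incidence-center n u = trans (incidence-suc n (center u)) (cong (2 * incidence n (center u) +_) (sumOf-* 6 _ (addresses n)))

mid-hits-same : ∀ w u j → hits (mid w j) (mid u j) ≡ hits (center w) (center u)
mid-hits-same w u j = hits-cong (λ { refl → refl }) (λ { refl → refl })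

mid-hits-other : ∀ w u {i j} → i ≢ j → hits (mid w i) (mid u j) ≡ 0
mid-hits-other w u i≢j = hits-distinct (λ { refl → i≢j refl })

midpoint-hits : ∀ u j w → hits (mid w 0F) (mid u j) + hits (mid w 1F) (mid u j) + hits (mid w 2F) (mid u j)
                          ≡ hits (center w) (center u)
midpoint-hits u 0F w rewrite mid-hits-other w u {1F} {0F} (λ ()) | mid-hits-other w u {2F} {0F} (λ ()) =
  trans (+-identityʳ _) (trans (+-identityʳ _) (mid-hits-same w u 0F))
midpoint-hits u 1F w rewrite mid-hits-other w u {0F} {1F} (λ ()) | mid-hits-other w u {2F} {1F} (λ ()) =
  trans (+-identityʳ _) (mid-hits-same w u 1F)
midpoint-hits u 2F w rewrite mid-hits-other w u {0F} {2F} (λ ()) | mid-hits-other w u {1F} {2F} (λ ()) =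
  mid-hits-same w u 2F

incidence-mid : ∀ n u j → incidence (suc n) (mid u j) ≡ 2 * incidence n (mid u j) + 2 * addressCount n u
incidence-mid n u j = trans (incidence-suc n (mid u j)) (cong (2 * incidence n (mid u j) +_)
  (trans (sumOf-cong (λ w → trans (+-identityʳ _) (cong (2 *_) (midpoint-hits u j w))) (addresses n))
         (sumOf-* 2 _ (addresses n))))

incidence-center-closed : ∀ u n → suc (length u) ≤ n → incidence n (center u) ≡ 6 * 2 ^ (n ∸ suc (length u))
incidence-center-closed u = appears-then-scales (λ n → incidence n (center u)) (λ n → 6 * addressCount n u)
  2 (length u) 6 refl (λ n → incidence-center n u)
  (λ n n≢|u| → cong (6 *_) (addressCount-elsewhere n≢|u|)) (cong (6 *_) (addressCount-here u))

incidence-mid-closed : ∀ u j n → suc (length u) ≤ n → incidence n (mid u j) ≡ 2 * 2 ^ (n ∸ suc (length u))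
incidence-mid-closed u j = appears-then-scales (λ n → incidence n (mid u j)) (λ n → 2 * addressCount n u)
  2 (length u) 2 refl (λ n → incidence-mid n u j)
  (λ n n≢|u| → cong (2 *_) (addressCount-elsewhere n≢|u|)) (cong (2 *_) (addressCount-here u))

degree-corner : ∀ n i → degree n (corner i) ≡ 2 ^ (n + 1)
degree-corner n i = begin
  degree n (corner i)             ≡⟨ degree≡2*incidence n (corner i) ⟩
  2 * incidence n (corner i)      ≡⟨ cong (2 *_) (incidence-corner n i) ⟩
  2 ^ (1 + n)                     ≡⟨ cong (2 ^_) (+-comm 1 n) ⟩
  2 ^ (n + 1)                     ∎
  where open ≡-Reasoning

degree-center : ∀ n u → suc (length u) ≤ n → degree n (center u) ≡ 3 * 2 ^ (n ∸ suc (length u) + 2)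
degree-center n u |u|<n = begin
  degree n (center u)         ≡⟨ degree≡2*incidence n (center u) ⟩
  2 * incidence n (center u)  ≡⟨ cong (2 *_) (incidence-center-closed u n |u|<n) ⟩
  2 * (6 * 2 ^ d)             ≡⟨ twelve (2 ^ d) ⟩
  3 * (2 ^ d * 2 ^ 2)         ≡⟨ cong (3 *_) (^-distribˡ-+-* 2 d 2) ⟨
  3 * 2 ^ (d + 2)             ∎
  where
  open ≡-Reasoning
  d : ℕ
  d = n ∸ suc (length u)
  twelve : ∀ x → 2 * (6 * x) ≡ 3 * (x * 4)
  twelve = solve-∀

degree-mid : ∀ n u j → suc (length u) ≤ n → degree n (mid u j) ≡ 2 ^ (n ∸ suc (length u) + 2)
degree-mid n u j |u|<n = begin
  degree n (mid u j)          ≡⟨ degree≡2*incidence n (mid u j) ⟩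
  2 * incidence n (mid u j)   ≡⟨ cong (2 *_) (incidence-mid-closed u j n |u|<n) ⟩
  2 * (2 * 2 ^ d)             ≡⟨ four (2 ^ d) ⟩
  2 ^ d * 2 ^ 2               ≡⟨ ^-distribˡ-+-* 2 d 2 ⟨
  2 ^ (d + 2)                 ∎
  where
  open ≡-Reasoning
  d : ℕ
  d = n ∸ suc (length u)
  four : ∀ x → 2 * (2 * x) ≡ x * 4
  four = solve-∀

degree-original : ∀ n v → classOf v ≡ original → degree n v ≡ 2 ^ (n + 1)
degree-original n (corner i) refl = degree-corner n i

degree-centerAt : ∀ n k → k ≤ n → ∀ v → classOf v ≡ centerAt k → degree n v ≡ 3 * 2 ^ (n ∸ k + 2)
degree-centerAt n .(suc (length u)) k≤n (center u) refl = degree-center n u k≤n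

degree-midAt : ∀ n k → k ≤ n → ∀ v → classOf v ≡ midAt k → degree n v ≡ 2 ^ (n ∸ k + 2)
degree-midAt n .(suc (length u)) k≤n (mid u j) refl = degree-mid n u j k≤n

cornersOf : ATriangle → List Vtx
cornersOf (_ , (a , b , c)) = a ∷ b ∷ c ∷ []

midpoints : List (Fin 6) → List Vtx
midpoints w = mid w 0F ∷ mid w 1F ∷ mid w 2F ∷ []

newVertices : List (Fin 6) → List Vtx
newVertices w = center w ∷ midpoints w

occurrences : ℕ → List Vtx
occurrences n = concatMap cornersOf (triangles n)

layer : ℕ → List Vtx
layer n = concatMap newVertices (addresses n)

vertexList : ℕ → List Vtx
vertexList zero = corner 0F ∷ corner 1F ∷ corner 2F ∷ []
vertexList (suc n) = vertexList n ++ layer n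

children-corners⊆ : ∀ t → concatMap cornersOf (subdivide t) ⊆ cornersOf t ++ newVertices (proj₁ t)
children-corners⊆ (w , (a , b , c)) =
  All.lookup {P = _∈ R} (a∈ ∷ m₀∈ ∷ o∈ ∷ m₀∈ ∷ b∈ ∷ o∈ ∷ b∈ ∷ m₁∈ ∷ o∈ ∷ m₁∈ ∷ c∈ ∷ o∈ ∷ c∈ ∷ m₂∈ ∷ o∈ ∷ m₂∈ ∷ a∈ ∷ o∈ ∷ [])
  where
  R : List Vtx
  R = a ∷ b ∷ c ∷ center w ∷ mid w 0F ∷ mid w 1F ∷ mid w 2F ∷ []
  a∈ : a ∈ R
  a∈ = here refl
  b∈ : b ∈ R
  b∈ = there (here refl)
  c∈ : c ∈ R
  c∈ = there (there (here refl))
  o∈ : center w ∈ R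
  o∈ = there (there (there (here refl)))
  m₀∈ : mid w 0F ∈ R
  m₀∈ = there (there (there (there (here refl))))
  m₁∈ : mid w 1F ∈ R
  m₁∈ = there (there (there (there (there (here refl)))))
  m₂∈ : mid w 2F ∈ R
  m₂∈ = there (there (there (there (there (there (here refl))))))

-- Conversely a, b, c, o, m_ab, m_bc, m_ca are corners of the children
-- number 1, 2, 4, 1, 1, 3, 5 respectively.
children-corners⊇ : ∀ t → cornersOf t ++ newVertices (proj₁ t) ⊆ concatMap cornersOf (subdivide t)
children-corners⊇ (w , (a , b , c)) =
  All.lookup (child (here refl) (here refl)
            ∷ child (there (here refl)) (there (here refl))
            ∷ child (there (there (there (here refl)))) (there (here refl))
            ∷ child (here refl) (there (there (here refl)))
            ∷ child (here refl) (there (here refl))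
            ∷ child (there (there (here refl))) (there (here refl))
            ∷ child (there (there (there (there (here refl))))) (there (here refl))
            ∷ [])
  where
  child : ∀ {s x} → s ∈ subdivide (w , (a , b , c)) → x ∈ cornersOf s →
    x ∈ concatMap cornersOf (subdivide (w , (a , b , c)))
  child s∈ x∈s = ∈-concatMap⁺ cornersOf (lose s∈ x∈s)

occurrences-suc⊆ : ∀ n → occurrences (suc n) ⊆ occurrences n ++ layer n
occurrences-suc⊆ n v∈ with find (AnyP.concatMap⁻ subdivide (∈-concatMap⁻ cornersOf {xs = concatMap subdivide (triangles n)} v∈))
... | t , t∈ , v∈children with ∈-++⁻ (cornersOf t) (children-corners⊆ t (∈-concatMap⁺ cornersOf v∈children))
...   | inj₁ v∈t = ∈-++⁺ˡ (∈-concatMap⁺ cornersOf {xs = triangles n} (lose t∈ v∈t))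
...   | inj₂ v∈new = ∈-++⁺ʳ (occurrences n) (∈-concatMap⁺ newVertices {xs = addresses n} (lose (∈-map⁺ proj₁ t∈) v∈new))

subdivision-occurs : ∀ n {t v} → t ∈ triangles n → v ∈ cornersOf t ++ newVertices (proj₁ t) → v ∈ occurrences (suc n)
subdivision-occurs n {t} t∈ v∈ = ∈-concatMap⁺ cornersOf
  (AnyP.concatMap⁺ subdivide (lose t∈ (∈-concatMap⁻ cornersOf {xs = subdivide t} (children-corners⊇ t v∈))))

occurrences-suc⊇ : ∀ n → occurrences n ++ layer n ⊆ occurrences (suc n)
occurrences-suc⊇ n v∈ with ∈-++⁻ (occurrences n) v∈
... | inj₁ v∈old with find (∈-concatMap⁻ cornersOf {xs = triangles n} v∈old)
...   | t , t∈ , v∈t = subdivision-occurs n t∈ (∈-++⁺ˡ v∈t)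
occurrences-suc⊇ n v∈ | inj₂ v∈layer with find (AnyP.map⁻ (∈-concatMap⁻ newVertices {xs = addresses n} v∈layer))
...   | t , t∈ , v∈new = subdivision-occurs n t∈ (∈-++⁺ʳ (cornersOf t) v∈new)

occurrences⊆vertexList : ∀ n → occurrences n ⊆ vertexList n
occurrences⊆vertexList zero = id
occurrences⊆vertexList (suc n) v∈ = ++⁺ (occurrences⊆vertexList n) id (occurrences-suc⊆ n v∈)

vertexList⊆occurrences : ∀ n → vertexList n ⊆ occurrences n
vertexList⊆occurrences zero = id
vertexList⊆occurrences (suc n) v∈ = occurrences-suc⊇ n (++⁺ (vertexList⊆occurrences n) id v∈)

classLevel : VClass → ℕ
classLevel original = 0
classLevel (centerAt k) = k
classLevel (midAt k) = k

layer-level : ∀ n {v} → v ∈ layer n → classLevel (classOf v) ≡ suc n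
layer-level n v∈ with find (∈-concatMap⁻ newVertices {xs = addresses n} v∈)
... | w , w∈ , here refl = cong suc (addresses-length n w∈)
... | w , w∈ , there (here refl) = cong suc (addresses-length n w∈)
... | w , w∈ , there (there (here refl)) = cong suc (addresses-length n w∈)
... | w , w∈ , there (there (there (here refl))) = cong suc (addresses-length n w∈)

vertexList-level : ∀ n {v} → v ∈ vertexList n → classLevel (classOf v) ≤ n
vertexList-level zero (here refl) = z≤n
vertexList-level zero (there (here refl)) = z≤n
vertexList-level zero (there (there (here refl))) = z≤n
vertexList-level (suc n) v∈ with ∈-++⁻ (vertexList n) v∈
... | inj₁ v∈old = m≤n⇒m≤1+n (vertexList-level n v∈old)
... | inj₂ v∈layer = ≤-reflexive (layer-level n v∈layer)

birthAddress : Vtx → List (Fin 6)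
birthAddress (corner _) = []
birthAddress (center w) = w
birthAddress (mid w _) = w

birthAddress-new : ∀ {w v} → v ∈ newVertices w → birthAddress v ≡ w
birthAddress-new (here refl) = refl
birthAddress-new (there (here refl)) = refl
birthAddress-new (there (there (here refl))) = refl
birthAddress-new (there (there (there (here refl)))) = refl

newVertices-unique : ∀ w → Unique (newVertices w)
newVertices-unique w = ((λ ()) ∷ (λ ()) ∷ (λ ()) ∷ []) ∷ ((λ ()) ∷ (λ ()) ∷ []) ∷ ((λ ()) ∷ []) ∷ [] ∷ []

-- Layers are duplicate-free and lie strictly above all earlier vertices.
vertexList-unique : ∀ n → Unique (vertexList n)
vertexList-unique zero = ((λ ()) ∷ (λ ()) ∷ []) ∷ ((λ ()) ∷ []) ∷ [] ∷ []
vertexList-unique (suc n) = UniqueP.++⁺ (vertexList-unique n)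
  (unique-concatMap newVertices birthAddress birthAddress-new newVertices-unique (addresses-unique n))
  (λ (v∈old , v∈layer) → <-irrefl (layer-level n v∈layer) (s≤s (vertexList-level n v∈old)))

vertices↭vertexList : ∀ n → vertices n ↭ vertexList n
vertices↭vertexList n = ∼bag⇒↭ (unique∧set⇒bag (deduplicate-! _) (vertexList-unique n)
  (mk⇔ (λ v∈ → occurrences⊆vertexList n (∈-deduplicate⁻ _≟V_ (occurrences n) v∈))
       (λ v∈ → ∈-deduplicate⁺ _≟V_ (vertexList⊆occurrences n v∈))))

isOfClass : (c : VClass) → Decidable (λ v → classOf v ≡ c)
isOfClass c v = classOf v ≟C c

classCount : VClass → List Vtx → ℕ
classCount c xs = length (filter (isOfClass c) xs)

classCount-++ : ∀ c xs ys → classCount c (xs ++ ys) ≡ classCount c xs + classCount c ys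
classCount-++ c xs ys = trans (cong length (ListP.filter-++ (isOfClass c) xs ys)) (ListP.length-++ (filter (isOfClass c) xs))

classCount-layer : ∀ c n m → (∀ w → length w ≡ n → classCount c (newVertices w) ≡ m) → classCount c (layer n) ≡ 6 ^ n * m
classCount-layer c n m uniform = begin
  length (filter (isOfClass c) (concatMap newVertices (addresses n)))  ≡⟨ cong length (filter-concatMap (isOfClass c) newVertices (addresses n)) ⟩
  length (concatMap (filter (isOfClass c) ∘ newVertices) (addresses n)) ≡⟨ length-concatMap-uniform _ (addresses n) (λ w∈ → uniform _ (addresses-length n w∈)) ⟩
  length (addresses n) * m                                             ≡⟨ cong (_* m) (length-addresses n) ⟩
  6 ^ n * m                                                            ∎
  where open ≡-Reasoning

centers-new : ∀ w {k} → suc (length w) ≡ k → classCount (centerAt k) (newVertices w) ≡ 1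
centers-new w {k} level≡k = cong length (ListP.filter-accept (isOfClass (centerAt k)) {x = center w} {xs = midpoints w} (cong centerAt level≡k))

centers-new-other : ∀ w {k} → suc (length w) ≢ k → classCount (centerAt k) (newVertices w) ≡ 0
centers-new-other w {k} level≢k = cong length (ListP.filter-reject (isOfClass (centerAt k)) {x = center w} {xs = midpoints w} (level≢k ∘ cong classLevel))

mids-new : ∀ w {k} → suc (length w) ≡ k → classCount (midAt k) (newVertices w) ≡ 3
mids-new w {k} level≡k = cong length (ListP.filter-all (isOfClass (midAt k)) (same ∷ same ∷ same ∷ []))
  where
  same : midAt (suc (length w)) ≡ midAt k
  same = cong midAt level≡k

mids-new-other : ∀ w {k} → suc (length w) ≢ k → classCount (midAt k) (newVertices w) ≡ 0
mids-new-other w {k} level≢k = cong length (ListP.filter-none (isOfClass (midAt k)) (other ∷ other ∷ other ∷ []))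
  where
  other : midAt (suc (length w)) ≢ midAt k
  other = level≢k ∘ cong classLevel

classCount-step : ∀ c n → classCount c (vertexList (suc n)) ≡ 1 * classCount c (vertexList n) + classCount c (layer n)
classCount-step c n = trans (classCount-++ c (vertexList n) (layer n)) (cong (_+ classCount c (layer n)) (sym (*-identityˡ _)))

classCount-born : ∀ c L κ → classCount c (vertexList 0) ≡ 0 → (∀ n → n ≢ L → classCount c (layer n) ≡ 0) →
  classCount c (layer L) ≡ κ → ∀ n → suc L ≤ n → classCount c (vertexList n) ≡ κ
classCount-born c L κ initially quiet burst n L<n = begin
  classCount c (vertexList n)  ≡⟨ appears-then-scales (λ m → classCount c (vertexList m)) (λ m → classCount c (layer m))
                                    1 L κ initially (classCount-step c) quiet burst n L<n ⟩
  κ * 1 ^ (n ∸ suc L)          ≡⟨ cong (κ *_) (^-zeroˡ (n ∸ suc L)) ⟩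
  κ * 1                        ≡⟨ *-identityʳ κ ⟩
  κ                            ∎
  where open ≡-Reasoning

-- Centres of level L+1: one per triangle of G_L; midpoints: three.
centerCount : ∀ L n → suc L ≤ n → classCount (centerAt (suc L)) (vertexList n) ≡ 6 ^ L
centerCount L = classCount-born (centerAt (suc L)) L (6 ^ L) refl quiet burst
  where
  quiet : ∀ m → m ≢ L → classCount (centerAt (suc L)) (layer m) ≡ 0
  quiet m m≢L = trans (classCount-layer _ m 0 (λ w |w|≡m → centers-new-other w (m≢L ∘ trans (sym |w|≡m) ∘ suc-injective)))
                      (*-zeroʳ (6 ^ m))
  burst : classCount (centerAt (suc L)) (layer L) ≡ 6 ^ L
  burst = trans (classCount-layer _ L 1 (λ w |w|≡L → centers-new w (cong suc |w|≡L))) (*-identityʳ (6 ^ L))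

midCount : ∀ L n → suc L ≤ n → classCount (midAt (suc L)) (vertexList n) ≡ 3 * 6 ^ L
midCount L = classCount-born (midAt (suc L)) L (3 * 6 ^ L) refl quiet burst
  where
  quiet : ∀ m → m ≢ L → classCount (midAt (suc L)) (layer m) ≡ 0
  quiet m m≢L = trans (classCount-layer _ m 0 (λ w |w|≡m → mids-new-other w (m≢L ∘ trans (sym |w|≡m) ∘ suc-injective)))
                      (*-zeroʳ (6 ^ m))
  burst : classCount (midAt (suc L)) (layer L) ≡ 3 * 6 ^ L
  burst = trans (classCount-layer _ L 3 (λ w |w|≡L → mids-new w (cong suc |w|≡L))) (*-comm (6 ^ L) 3)

-- No layer contains an original corner.
cornerCount : ∀ n → classCount original (vertexList n) ≡ 3
cornerCount zero = refl
cornerCount (suc n) = begin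
  classCount original (vertexList n ++ layer n)                   ≡⟨ classCount-++ original (vertexList n) (layer n) ⟩
  classCount original (vertexList n) + classCount original (layer n) ≡⟨ cong₂ _+_ (cornerCount n) (classCount-layer original n 0 (λ _ _ → refl)) ⟩
  3 + 6 ^ n * 0                                                   ≡⟨ cong (3 +_) (*-zeroʳ (6 ^ n)) ⟩
  3                                                               ∎
  where open ≡-Reasoning

-- 5·|V(G_n)| = 4·6^n + 11, since layer n has 4·6^n vertices.
vertexCount : ∀ n → 5 * length (vertexList n) ≡ 4 * 6 ^ n + 11
vertexCount zero = refl
vertexCount (suc n) = begin
  5 * length (vertexList n ++ layer n)               ≡⟨ cong (5 *_) (ListP.length-++ (vertexList n)) ⟩
  5 * (length (vertexList n) + length (layer n))     ≡⟨ *-distribˡ-+ 5 (length (vertexList n)) _ ⟩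
  5 * length (vertexList n) + 5 * length (layer n)   ≡⟨ cong₂ (λ x y → x + 5 * y) (vertexCount n) layer-size ⟩
  4 * 6 ^ n + 11 + 5 * (6 ^ n * 4)                   ≡⟨ regroup (6 ^ n) ⟩
  4 * 6 ^ suc n + 11                                 ∎
  where
  open ≡-Reasoning
  layer-size : length (layer n) ≡ 6 ^ n * 4
  layer-size = trans (length-concatMap-uniform newVertices (addresses n) (λ _ → refl)) (cong (_* 4) (length-addresses n))
  regroup : ∀ x → 4 * x + 11 + 5 * (x * 4) ≡ 4 * (6 * x) + 11
  regroup = solve-∀

length-verticesOf : ∀ n c → length (verticesOf n c) ≡ classCount c (vertexList n)
length-verticesOf n c = ↭-length (filter-↭ (isOfClass c) (vertices↭vertexList n))

all-verticesOf : ∀ n c {Q : Vtx → Set} → (∀ v → classOf v ≡ c → Q v) → All Q (verticesOf n c)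
all-verticesOf n c holds = All.tabulate (λ v∈ → holds _ (proj₂ (∈-filter⁻ (isOfClass c) {xs = vertices n} v∈)))

length-vertices : ∀ n → length (vertices n) ≡ (4 * 6 ^ n + 11) / 5
length-vertices n = begin
  length (vertices n)               ≡⟨ ↭-length (vertices↭vertexList n) ⟩
  length (vertexList n)             ≡⟨ m*n/n≡m (length (vertexList n)) 5 ⟨
  length (vertexList n) * 5 / 5     ≡⟨ cong (_/ 5) (trans (*-comm (length (vertexList n)) 5) (vertexCount n)) ⟩
  (4 * 6 ^ n + 11) / 5              ∎
  where open ≡-Reasoning

lemma5p4 : (n : ℕ) →
    length (vertices n) ≡ (4 * 6 ^ n + 11) / 5
  × (length (verticesOf n original) ≡ 3
     × All (λ v → degree n v ≡ 2 ^ (n + 1)) (verticesOf n original))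
  × ((k : ℕ) → 1 ≤ k → k ≤ n →
       length (verticesOf n (centerAt k)) ≡ 6 ^ (k ∸ 1)
     × All (λ v → degree n v ≡ 3 * 2 ^ (n ∸ k + 2)) (verticesOf n (centerAt k)))
  × ((k : ℕ) → 1 ≤ k → k ≤ n →
       length (verticesOf n (midAt k)) ≡ 3 * 6 ^ (k ∸ 1)
     × All (λ v → degree n v ≡ 2 ^ (n ∸ k + 2)) (verticesOf n (midAt k)))
lemma5p4 n =
    length-vertices n
  , ( trans (length-verticesOf n original) (cornerCount n)
    , all-verticesOf n original (degree-original n) )
  , (λ { zero ()
     ; (suc L) _ k≤n →
         trans (length-verticesOf n (centerAt (suc L))) (centerCount L n k≤n)
       , all-verticesOf n (centerAt (suc L)) (degree-centerAt n (suc L) k≤n) })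
  , (λ { zero ()
     ; (suc L) _ k≤n →
         trans (length-verticesOf n (midAt (suc L))) (midCount L n k≤n)
       , all-verticesOf n (midAt (suc L)) (degree-midAt n (suc L) k≤n) })
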